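{- Let $H$ be a graph with vertex set $V(H)=\{v_1,\ldots,v_k\}$ and let $a_1,\ldots,a_k$ be positive integers. Let $H'(a_1,\ldots,a_k)$ be the blow-up of $H$, i.e. the graph with vertex set $\{(v_i,j): i\in[k],\ j\in[a_i]\}$ in which $(v_{i_1},j_1)$ and $(v_{i_2},j_2)$ are adjacent if and only if $\{v_{i_1},v_{i_2}\}\in E(H)$. Then for every graph $T$, $$t(H'(a_1,\ldots,a_k),T)\geq t(H,T)^{a_1a_2\cdots a_k}.$$
   Context: All graphs are finite and simple. For graphs $H$ and $T$, $\operatorname{hom}(H,T)$ is the number of maps $V(H)\to V(T)$ sending every edge of $H$ to an edge of $T$, and the homomorphism density is $t(H,T)=\operatorname{hom}(H,T)/v(T)^{v(H)}$, where $v(\cdot)$ denotes the number of vertices. -}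

module Defs where

open import Data.Nat as ℕ using (ℕ; zero; suc; _+_; _*_; _^_; NonZero)
open import Data.Nat.Properties using (m^n≢0)
open import Data.Fin using (Fin; zero; suc; splitAt)
open import Data.Fin.Properties using (all?)
open import Data.Bool using (Bool; true; false; T; _∧_; _∨_; not)
open import Data.Sum using (inj₁; inj₂)
open import Data.List using (List; []; _∷_; map; concatMap; length; filter; allFin)
open import Data.Vec.Functional as VF using ()
open import Data.Integer using (+_)
open import Data.Rational using (ℚ; _/_; 1ℚ) renaming (_*_ to _*ℚ_)
open import Relation.Binary.PropositionalEquality using (_≡_)
open import Relation.Nullary.Decidable using (Dec; yes; no)
open import Data.Bool using (T?)

record Graph (n : ℕ) : Set where
  field
    adj    : Fin n → Fin n → Bool
    sym    : ∀ i j → adj i j ≡ adj j i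
    irrefl : ∀ i → adj i i ≡ false
open Graph public

allMaps : (k n : ℕ) → List (Fin k → Fin n)
allMaps zero    n = (λ ()) ∷ []
allMaps (suc k) n = concatMap (λ x → map (λ f → x VF.∷ f) (allMaps k n)) (allFin n)

IsHom : ∀ {k n} → Graph k → Graph n → (Fin k → Fin n) → Set
IsHom H G f = ∀ i j → T (adj H i j) → T (adj G (f i) (f j))

isHom? : ∀ {k n} (H : Graph k) (G : Graph n) (f : Fin k → Fin n) → Dec (IsHom H G f)
isHom? H G f = all? λ i → all? λ j → decImp (adj H i j) (adj G (f i) (f j))
  where
  decImp : (a b : Bool) → Dec (T a → T b)
  decImp false b    = yes (λ ())
  decImp true  true = yes (λ _ → _)
  decImp true  false = no (λ g → g _)

hom : ∀ {k n} → Graph k → Graph n → ℕ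
hom H G = length (filter (isHom? H G) (allMaps _ _))

t : ∀ {k m} → Graph k → Graph (suc m) → ℚ
t {k} {m} H G = (+ hom H G) / (suc m ^ k)
  where instance _ = m^n≢0 (suc m) k

_^ℚ_ : ℚ → ℕ → ℚ
p ^ℚ zero  = 1ℚ
p ^ℚ suc e = p *ℚ (p ^ℚ e)

prodF : (k : ℕ) → (Fin k → ℕ) → ℕ
prodF zero    a = 1
prodF (suc k) a = a zero * prodF k (λ i → a (suc i))

sizeB : (k : ℕ) → (Fin k → ℕ) → ℕ
sizeB zero    a = 0
sizeB (suc k) a = a zero + sizeB k (λ i → a (suc i))

-- Vertices of the blow-up are Fin (a_1+⋯+a_k), the block of a_i consecutive
-- indices standing for (v_i,1),…,(v_i,a_i); proj sends (v_i,j) to i.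
proj : (k : ℕ) (a : Fin k → ℕ) → Fin (sizeB k a) → Fin k
proj (suc k) a x with splitAt (a zero) x
... | inj₁ _ = zero
... | inj₂ y = suc (proj k (λ i → a (suc i)) y)

blowUp : ∀ {k} → Graph k → (a : Fin k → ℕ) → Graph (sizeB k a)
blowUp {k} H a = record
  { adj    = λ x y → adj H (proj k a x) (proj k a y)
  ; sym    = λ x y → sym H (proj k a x) (proj k a y)
  ; irrefl = λ x → irrefl H (proj k a x)
  }

{-# OPTIONS --safe #-}
-- Replace "is a homomorphism from H" by an arbitrary property b of k-tuples of vertices of
-- T and induct on k. After blowing up the first vertex into a copies, a tuple (x₁,…,x_a, y)
-- qualifies iff every (xⱼ, y) satisfies b, so the count is ∑_y N(y)^a, where N(y) counts
-- the admissible first coordinates; by the power-mean inequality (a consequence of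
-- Chebyshev's sum inequality) this is at least the a-th power of ∑_y N(y), suitably
-- normalised. The induction hypothesis, applied to each fibre over (x₁,…,x_a) and averaged
-- once more with the power-mean inequality, supplies the remaining exponent.
module Submission where

module Sums where

  open import Algebra.Properties.CommutativeSemigroup using (interchange)
  open import Data.Bool using (Bool; true; false)
  open import Data.List using (List; []; _∷_; _++_; map; concatMap; length; filter)
  open import Data.Nat using (ℕ; zero; suc; _+_; _*_; _^_; _≤_; z≤n)
  open import Data.Nat.Properties
  open import Data.Nat.Tactic.RingSolver using (solve-∀)
  open import Data.Product using (_,_)
  open import Data.Sum using (inj₁; inj₂)
  open import Relation.Binary.PropositionalEquality
  open import Relation.Nullary.Decidable using (yes; no; isYes)
  open import Relation.Unary using (Decidable)

  infix 5 ∑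

  ∑ : {A : Set} → List A → (A → ℕ) → ℕ
  ∑ []       f = 0
  ∑ (x ∷ xs) f = f x + ∑ xs f

  syntax ∑ xs (λ x → e) = ∑[ x ∈ xs ] e

  𝟙 : Bool → ℕ
  𝟙 true  = 1
  𝟙 false = 0

  module _ {A : Set} where

    ∑-cong : ∀ (xs : List A) {f g : A → ℕ} → f ≗ g → ∑ xs f ≡ ∑ xs g
    ∑-cong []       f≗g = refl
    ∑-cong (x ∷ xs) f≗g = cong₂ _+_ (f≗g x) (∑-cong xs f≗g)

    ∑-mono-≤ : ∀ (xs : List A) {f g : A → ℕ} → (∀ x → f x ≤ g x) → ∑ xs f ≤ ∑ xs g
    ∑-mono-≤ []       f≤g = z≤n
    ∑-mono-≤ (x ∷ xs) f≤g = +-mono-≤ (f≤g x) (∑-mono-≤ xs f≤g)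

    ∑-distrib-+ : ∀ (xs : List A) (f g : A → ℕ) → ∑[ x ∈ xs ] f x + g x ≡ ∑ xs f + ∑ xs g
    ∑-distrib-+ []       f g = refl
    ∑-distrib-+ (x ∷ xs) f g = trans (cong (f x + g x +_) (∑-distrib-+ xs f g))
                                     (interchange +-commutativeSemigroup (f x) (g x) (∑ xs f) (∑ xs g))

    *-distribˡ-∑ : ∀ c (xs : List A) (f : A → ℕ) → c * ∑ xs f ≡ ∑[ x ∈ xs ] c * f x
    *-distribˡ-∑ c []       f = *-zeroʳ c
    *-distribˡ-∑ c (x ∷ xs) f = trans (*-distribˡ-+ c (f x) (∑ xs f)) (cong (c * f x +_) (*-distribˡ-∑ c xs f))

    *-distribʳ-∑ : ∀ c (xs : List A) (f : A → ℕ) → ∑ xs f * c ≡ ∑[ x ∈ xs ] f x * c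
    *-distribʳ-∑ c xs f = trans (*-comm (∑ xs f) c) (trans (*-distribˡ-∑ c xs f) (∑-cong xs (λ x → *-comm c (f x))))

    ∑-const : ∀ (xs : List A) c → ∑[ _ ∈ xs ] c ≡ length xs * c
    ∑-const []       c = refl
    ∑-const (x ∷ xs) c = cong (c +_) (∑-const xs c)

    ∑-1 : ∀ (xs : List A) → ∑[ _ ∈ xs ] 1 ≡ length xs
    ∑-1 xs = trans (∑-const xs 1) (*-identityʳ (length xs))

    ∑-++ : ∀ (xs ys : List A) (f : A → ℕ) → ∑ (xs ++ ys) f ≡ ∑ xs f + ∑ ys f
    ∑-++ []       ys f = refl
    ∑-++ (x ∷ xs) ys f = trans (cong (f x +_) (∑-++ xs ys f)) (sym (+-assoc (f x) _ _))

    length-filter : ∀ {P : A → Set} (P? : Decidable P) xs → length (filter P? xs) ≡ ∑[ x ∈ xs ] 𝟙 (isYes (P? x))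
    length-filter P? []       = refl
    length-filter P? (x ∷ xs) with P? x
    ... | yes _ = cong suc (length-filter P? xs)
    ... | no  _ = length-filter P? xs

  module _ {A B : Set} where

    ∑-map : ∀ (h : A → B) xs (f : B → ℕ) → ∑ (map h xs) f ≡ ∑[ x ∈ xs ] f (h x)
    ∑-map h []       f = refl
    ∑-map h (x ∷ xs) f = cong (f (h x) +_) (∑-map h xs f)

    ∑-concatMap : ∀ (h : A → List B) xs (f : B → ℕ) → ∑ (concatMap h xs) f ≡ ∑[ x ∈ xs ] ∑ (h x) f
    ∑-concatMap h []       f = refl
    ∑-concatMap h (x ∷ xs) f = trans (∑-++ (h x) (concatMap h xs) f) (cong (∑ (h x) f +_) (∑-concatMap h xs f))

    ∑-comm : ∀ (xs : List A) (ys : List B) (f : A → B → ℕ) →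
             ∑[ x ∈ xs ] ∑[ y ∈ ys ] f x y ≡ ∑[ y ∈ ys ] ∑[ x ∈ xs ] f x y
    ∑-comm []       ys f = sym (trans (∑-const ys 0) (*-zeroʳ (length ys)))
    ∑-comm (x ∷ xs) ys f = trans (cong (∑ ys (f x) +_) (∑-comm xs ys f))
                                 (sym (∑-distrib-+ ys (f x) (λ y → ∑[ x ∈ xs ] f x y)))

    ∑-*-∑ : ∀ (xs : List A) (ys : List B) (f : A → ℕ) (g : B → ℕ) →
            ∑[ x ∈ xs ] ∑[ y ∈ ys ] f x * g y ≡ ∑ xs f * ∑ ys g
    ∑-*-∑ xs ys f g = begin
      ∑[ x ∈ xs ] ∑[ y ∈ ys ] f x * g y ≡⟨ ∑-cong xs (λ x → *-distribˡ-∑ (f x) ys g) ⟨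
      ∑[ x ∈ xs ] f x * ∑ ys g          ≡⟨ *-distribʳ-∑ (∑ ys g) xs f ⟨
      ∑ xs f * ∑ ys g                   ∎
      where open ≡-Reasoning

  ∑-symmetrise : ∀ {A} (xs : List A) (f : A → A → ℕ) →
                 ∑[ x ∈ xs ] ∑[ y ∈ xs ] f x y + f y x ≡ 2 * (∑[ x ∈ xs ] ∑[ y ∈ xs ] f x y)
  ∑-symmetrise xs f = begin
    ∑[ x ∈ xs ] ∑[ y ∈ xs ] f x y + f y x                              ≡⟨ ∑-cong xs (λ x → ∑-distrib-+ xs (f x) (λ y → f y x)) ⟩
    ∑[ x ∈ xs ] (∑[ y ∈ xs ] f x y) + (∑[ y ∈ xs ] f y x)              ≡⟨ ∑-distrib-+ xs _ _ ⟩
    (∑[ x ∈ xs ] ∑[ y ∈ xs ] f x y) + (∑[ x ∈ xs ] ∑[ y ∈ xs ] f y x)  ≡⟨ cong (S +_) (∑-comm xs xs (λ x y → f y x)) ⟩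
    S + S                                                              ≡⟨ cong (S +_) (+-identityʳ S) ⟨
    2 * S                                                              ∎
    where
    open ≡-Reasoning
    S = ∑[ x ∈ xs ] ∑[ y ∈ xs ] f x y

  rearrangement : ∀ {a b c d} → a ≤ b → c ≤ d → a * d + b * c ≤ a * c + b * d
  rearrangement {a} {c = c} a≤b c≤d with m≤n⇒∃[o]m+o≡n a≤b | m≤n⇒∃[o]m+o≡n c≤d
  ... | u , refl | v , refl = ≤-trans (m≤m+n _ (u * v)) (≤-reflexive (expand a c u v))
    where
    expand : ∀ a c u v → a * (c + v) + (a + u) * c + u * v ≡ a * c + (a + u) * (c + v)
    expand = solve-∀

  chebyshev : ∀ {A} (xs : List A) (u v : A → ℕ) → (∀ x y → u x ≤ u y → v x ≤ v y) →
              ∑ xs u * ∑ xs v ≤ length xs * (∑[ x ∈ xs ] u x * v x)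
  chebyshev xs u v similarlyOrdered = *-cancelˡ-≤ 2 (begin
    2 * (∑ xs u * ∑ xs v)                           ≡⟨ cong (2 *_) (∑-*-∑ xs xs u v) ⟨
    2 * (∑[ x ∈ xs ] ∑[ y ∈ xs ] u x * v y)         ≡⟨ ∑-symmetrise xs (λ x y → u x * v y) ⟨
    ∑[ x ∈ xs ] ∑[ y ∈ xs ] u x * v y + u y * v x   ≤⟨ ∑-mono-≤ xs (λ x → ∑-mono-≤ xs (pairwise x)) ⟩
    ∑[ x ∈ xs ] ∑[ y ∈ xs ] u x * v x + u y * v y   ≡⟨ ∑-symmetrise xs (λ x y → u x * v x) ⟩
    2 * (∑[ x ∈ xs ] ∑[ y ∈ xs ] u x * v x)         ≡⟨ cong (2 *_) (∑-cong xs (λ x → ∑-const xs (u x * v x))) ⟩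
    2 * (∑[ x ∈ xs ] length xs * (u x * v x))       ≡⟨ cong (2 *_) (*-distribˡ-∑ (length xs) xs (λ x → u x * v x)) ⟨
    2 * (length xs * (∑[ x ∈ xs ] u x * v x))       ∎)
    where
    open ≤-Reasoning
    pairwise : ∀ x y → u x * v y + u y * v x ≤ u x * v x + u y * v y
    pairwise x y with ≤-total (u x) (u y)
    ... | inj₁ ux≤uy = rearrangement ux≤uy (similarlyOrdered x y ux≤uy)
    ... | inj₂ uy≤ux = subst₂ _≤_ (+-comm (u y * v x) (u x * v y)) (+-comm (u y * v y) (u x * v x))
                                  (rearrangement uy≤ux (similarlyOrdered y x uy≤ux))

  power-mean : ∀ {A} (xs : List A) (u : A → ℕ) p →
               ∑ xs u ^ p * length xs ≤ (∑[ x ∈ xs ] u x ^ p) * length xs ^ p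
  power-mean xs u zero = ≤-reflexive (begin-equality
    1 * N                ≡⟨ *-comm 1 N ⟩
    N * 1                ≡⟨ cong (_* 1) (∑-1 xs) ⟨
    (∑[ _ ∈ xs ] 1) * 1  ∎)
    where
    open ≤-Reasoning
    N = length xs
  power-mean xs u (suc p) = begin
    U * U ^ p * N                               ≡⟨ *-assoc U (U ^ p) N ⟩
    U * (U ^ p * N)                             ≤⟨ *-monoʳ-≤ U (power-mean xs u p) ⟩
    U * ((∑[ x ∈ xs ] u x ^ p) * N ^ p)         ≡⟨ *-assoc U _ (N ^ p) ⟨
    U * (∑[ x ∈ xs ] u x ^ p) * N ^ p           ≤⟨ *-monoˡ-≤ (N ^ p) (chebyshev xs u (λ x → u x ^ p) (λ _ _ → ^-monoˡ-≤ p)) ⟩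
    N * S * N ^ p                               ≡⟨ cong (_* N ^ p) (*-comm N S) ⟩
    S * N * N ^ p                               ≡⟨ *-assoc S N (N ^ p) ⟩
    (∑[ x ∈ xs ] u x ^ suc p) * (N * N ^ p)     ∎
    where
    open ≤-Reasoning
    N = length xs
    U = ∑ xs u
    S = ∑[ x ∈ xs ] u x * u x ^ p

module Counting where

  open import Algebra.Properties.CommutativeSemigroup using (interchange; xy∙z≈xz∙y)
  open import Data.Bool using (Bool; true; false; T; _∧_)
  open import Data.Bool.Properties using (T-∧)
  open import Data.Empty using (⊥-elim)
  open import Data.Fin using (Fin; zero; suc; splitAt; _↑ˡ_; _↑ʳ_; fromℕ<)
  open import Data.Fin.Properties using (splitAt⁻¹-↑ˡ; splitAt⁻¹-↑ʳ; _≟_)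
  open import Data.List using (length; allFin)
  open import Data.List.Properties using (length-tabulate)
  open import Data.Nat using (ℕ; zero; suc; _+_; _*_; _^_; _≤_; _>_; z≤n; NonZero)
  open import Data.Nat.Properties hiding (_≟_)
  open import Data.Product using (∃-syntax; _,_; proj₁; proj₂)
  open import Data.Sum using (inj₁; inj₂)
  open import Data.Vec.Functional using (head; tail; take; drop; foldr; _∷_; _++_)
  open import Data.Vec.Functional.Properties using (∷-cong; lookup-++ˡ; lookup-++ʳ)
  open import Function using (_∘_; mk⇔; Equivalence)
  open import Relation.Binary.Core using (_Preserves_⟶_)
  open import Relation.Binary.PropositionalEquality
  open import Relation.Nullary using (yes; no)
  open import Relation.Nullary.Decidable using (isYes; toWitness; fromWitness; isYes≗does; does-⇔)
  open import Defs hiding (sym)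
  open Sums

  ^-distribʳ-* : ∀ x y p → (x * y) ^ p ≡ x ^ p * y ^ p
  ^-distribʳ-* x y zero    = refl
  ^-distribʳ-* x y (suc p) = trans (cong (x * y *_) (^-distribʳ-* x y p))
                                   (interchange *-commutativeSemigroup x y (x ^ p) (y ^ p))

  -- In terms of fractions: from w/r ≤ v/c, v/q ≤ u/d and u/c ≤ x/e follows w/(qr) ≤ x/(de).
  cross-≤-chain : ∀ {w v u x c r d q e} .{{_ : NonZero c}} →
                  w * c ≤ v * r → v * d ≤ u * q → u * e ≤ x * c → w * (d * e) ≤ x * (q * r)
  cross-≤-chain {w} {v} {u} {x} {c} {r} {d} {q} {e} h₁ h₂ h₃ = *-cancelʳ-≤ _ _ c (begin
    w * (d * e) * c  ≡⟨ xy∙z≈xz∙y *-commutativeSemigroup w (d * e) c ⟩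
    w * c * (d * e)  ≤⟨ *-monoˡ-≤ (d * e) h₁ ⟩
    v * r * (d * e)  ≡⟨ interchange *-commutativeSemigroup v r d e ⟩
    v * d * (r * e)  ≤⟨ *-monoˡ-≤ (r * e) h₂ ⟩
    u * q * (r * e)  ≡⟨ cong (u * q *_) (*-comm r e) ⟩
    u * q * (e * r)  ≡⟨ interchange *-commutativeSemigroup u q e r ⟩
    u * e * (q * r)  ≤⟨ *-monoˡ-≤ (q * r) h₃ ⟩
    x * c * (q * r)  ≡⟨ xy∙z≈xz∙y *-commutativeSemigroup x c (q * r) ⟩
    x * (q * r) * c  ∎)
    where open ≤-Reasoning

  ∷-++ : ∀ {A : Set} {a b} (x : A) (f : Fin a → A) (g : Fin b → A) → x ∷ (f ++ g) ≗ (x ∷ f) ++ g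
  ∷-++ x f g zero = refl
  ∷-++ {a = a} x f g (suc i) with splitAt a i
  ... | inj₁ _ = refl
  ... | inj₂ _ = refl

  𝟙-∧ : ∀ x y → 𝟙 (x ∧ y) ≡ 𝟙 x * 𝟙 y
  𝟙-∧ true  y = sym (+-identityʳ (𝟙 y))
  𝟙-∧ false y = refl

  𝟙-mono : ∀ {x y} → (T x → T y) → 𝟙 x ≤ 𝟙 y
  𝟙-mono {false}         _   = z≤n
  𝟙-mono {true}  {true}  _   = ≤-refl
  𝟙-mono {true}  {false} x⇒y = ⊥-elim (x⇒y _)

  every : ∀ {a} → (Fin a → Bool) → Bool
  every = foldr _∧_ true

  every-cong : ∀ {a} {u v : Fin a → Bool} → u ≗ v → every u ≡ every v
  every-cong {zero}  u≗v = refl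
  every-cong {suc a} u≗v = cong₂ _∧_ (u≗v zero) (every-cong (u≗v ∘ suc))

  T-every : ∀ {a} {u : Fin a → Bool} → T (every u) → ∀ j → T (u j)
  T-every {suc a} t zero    = proj₁ (Equivalence.to T-∧ t)
  T-every {suc a} t (suc j) = T-every (proj₂ (Equivalence.to T-∧ t)) j

  -- vertex a i j is the vertex (v_i, j) of the blow-up.
  vertex : ∀ {k} (a : Fin k → ℕ) (i : Fin k) → Fin (a i) → Fin (sizeB k a)
  vertex {suc k} a zero    j = j ↑ˡ sizeB k (tail a)
  vertex {suc k} a (suc i) j = head a ↑ʳ vertex (tail a) i j

  vertex-proj : ∀ {k} (a : Fin k → ℕ) x → ∃[ j ] vertex a (proj k a x) j ≡ x
  vertex-proj {suc k} a x with splitAt (head a) x in eq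
  ... | inj₁ j = j , splitAt⁻¹-↑ˡ eq
  ... | inj₂ y with j , vertex≡y ← vertex-proj (tail a) y = j , trans (cong (head a ↑ʳ_) vertex≡y) (splitAt⁻¹-↑ʳ eq)

  module _ {k} {F : Fin k → Set} where

    update : ((i : Fin k) → F i) → (i : Fin k) → F i → (i' : Fin k) → F i'
    update c i x i' with i ≟ i'
    ... | yes refl = x
    ... | no  _    = c i'

    update-≡ : ∀ c i x → update c i x i ≡ x
    update-≡ c i x with i ≟ i
    ... | yes refl = refl
    ... | no  i≢i  = ⊥-elim (i≢i refl)

    update-≢ : ∀ c {i i'} x → i ≢ i' → update c i x i' ≡ c i'
    update-≢ c {i} {i'} x i≢i' with i ≟ i'
    ... | yes i≡i' = ⊥-elim (i≢i' i≡i')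
    ... | no  _    = refl

  module _ {n : ℕ} where

    ∑-allMaps-suc : ∀ k (F : (Fin (suc k) → Fin n) → ℕ) →
                    ∑ (allMaps (suc k) n) F ≡ ∑[ x ∈ allFin n ] ∑[ f ∈ allMaps k n ] F (x ∷ f)
    ∑-allMaps-suc k F = trans (∑-concatMap _ (allFin n) F)
                              (∑-cong (allFin n) (λ x → ∑-map (x ∷_) (allMaps k n) F))

    length-allMaps : ∀ k → length (allMaps k n) ≡ n ^ k
    length-allMaps zero    = refl
    length-allMaps (suc k) = begin
      length (allMaps (suc k) n)                ≡⟨ ∑-1 (allMaps (suc k) n) ⟨
      ∑[ _ ∈ allMaps (suc k) n ] 1              ≡⟨ ∑-allMaps-suc k _ ⟩
      ∑[ _ ∈ allFin n ] ∑[ _ ∈ allMaps k n ] 1  ≡⟨ ∑-cong (allFin n) (λ _ → trans (∑-1 (allMaps k n)) (length-allMaps k)) ⟩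
      ∑[ _ ∈ allFin n ] n ^ k                   ≡⟨ ∑-const (allFin n) (n ^ k) ⟩
      length (allFin n) * n ^ k                 ≡⟨ cong (_* n ^ k) (length-tabulate {n = n} (λ i → i)) ⟩
      n * n ^ k                                 ∎
      where open ≡-Reasoning

    ∑-allMaps-++ : ∀ a b (F : (Fin (a + b) → Fin n) → ℕ) → F Preserves _≗_ ⟶ _≡_ →
                   ∑ (allMaps (a + b) n) F ≡ ∑[ f ∈ allMaps a n ] ∑[ g ∈ allMaps b n ] F (f ++ g)
    ∑-allMaps-++ zero    b F F-resp = sym (+-identityʳ _)
    ∑-allMaps-++ (suc a) b F F-resp = begin
      ∑ (allMaps (suc a + b) n) F
        ≡⟨ ∑-allMaps-suc (a + b) F ⟩
      ∑[ x ∈ allFin n ] ∑[ h ∈ allMaps (a + b) n ] F (x ∷ h)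
        ≡⟨ ∑-cong (allFin n) (λ x → ∑-allMaps-++ a b (F ∘ (x ∷_)) (F-resp ∘ ∷-cong refl)) ⟩
      ∑[ x ∈ allFin n ] ∑[ f ∈ allMaps a n ] ∑[ g ∈ allMaps b n ] F (x ∷ (f ++ g))
        ≡⟨ ∑-cong (allFin n) (λ x → ∑-cong (allMaps a n) (λ f → ∑-cong (allMaps b n) (λ g → F-resp (∷-++ x f g)))) ⟩
      ∑[ x ∈ allFin n ] ∑[ f ∈ allMaps a n ] ∑[ g ∈ allMaps b n ] F ((x ∷ f) ++ g)
        ≡⟨ ∑-allMaps-suc a _ ⟨
      ∑[ f ∈ allMaps (suc a) n ] ∑[ g ∈ allMaps b n ] F (f ++ g)
        ∎
      where open ≡-Reasoning

    ∑-allMaps-every : ∀ a (c : Fin n → Bool) →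
                      ∑[ g ∈ allMaps a n ] 𝟙 (every (c ∘ g)) ≡ (∑[ x ∈ allFin n ] 𝟙 (c x)) ^ a
    ∑-allMaps-every zero    c = refl
    ∑-allMaps-every (suc a) c = begin
      ∑[ g ∈ allMaps (suc a) n ] 𝟙 (every (c ∘ g))                         ≡⟨ ∑-allMaps-suc a _ ⟩
      ∑[ x ∈ allFin n ] ∑[ f ∈ allMaps a n ] 𝟙 (c x ∧ every (c ∘ f))       ≡⟨ ∑-cong (allFin n) (λ x → ∑-cong (allMaps a n) (λ f → 𝟙-∧ (c x) _)) ⟩
      ∑[ x ∈ allFin n ] ∑[ f ∈ allMaps a n ] 𝟙 (c x) * 𝟙 (every (c ∘ f))  ≡⟨ ∑-*-∑ (allFin n) (allMaps a n) _ _ ⟩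
      Q * (∑[ f ∈ allMaps a n ] 𝟙 (every (c ∘ f)))                         ≡⟨ cong (Q *_) (∑-allMaps-every a c) ⟩
      Q * Q ^ a                                                            ∎
      where
      open ≡-Reasoning
      Q = ∑[ x ∈ allFin n ] 𝟙 (c x)

    count : ∀ k → ((Fin k → Fin n) → Bool) → ℕ
    count k b = ∑[ f ∈ allMaps k n ] 𝟙 (b f)

    everyHead : ∀ {a k} → (Fin a → Fin n) → ((Fin (suc k) → Fin n) → Bool) → (Fin k → Fin n) → Bool
    everyHead xs b ys = every (λ j → b (xs j ∷ ys))

    -- blowUpProp k a b g holds iff b (λ i → g (vertex a i (c i))) holds for every choice c
    -- of one copy of each vertex.
    blowUpProp : ∀ k (a : Fin k → ℕ) → ((Fin k → Fin n) → Bool) → (Fin (sizeB k a) → Fin n) → Bool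
    blowUpProp zero    a b   = b
    blowUpProp (suc k) a b g = blowUpProp k (tail a) (everyHead (take (head a) g) b) (drop (head a) g)

    everyHead-resp : ∀ {a k} (xs : Fin a → Fin n) {b : (Fin (suc k) → Fin n) → Bool} →
                     b Preserves _≗_ ⟶ _≡_ → everyHead xs b Preserves _≗_ ⟶ _≡_
    everyHead-resp {a} xs b-resp ys≗ys' = every-cong {a} (λ j → b-resp (∷-cong refl ys≗ys'))

    everyHead-cong : ∀ {a k} {xs xs' : Fin a → Fin n} {b : (Fin (suc k) → Fin n) → Bool} →
                     b Preserves _≗_ ⟶ _≡_ → xs ≗ xs' → everyHead xs b ≗ everyHead xs' b
    everyHead-cong {a} b-resp xs≗xs' ys = every-cong {a} (λ j → b-resp (∷-cong (xs≗xs' j) (λ _ → refl)))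

    blowUpProp-cong : ∀ k a {b b' : (Fin k → Fin n) → Bool} → b ≗ b' → blowUpProp k a b ≗ blowUpProp k a b'
    blowUpProp-cong zero    a b≗b' = b≗b'
    blowUpProp-cong (suc k) a b≗b' g = blowUpProp-cong k (tail a) (λ ys → every-cong {head a} (λ j → b≗b' _)) (drop (head a) g)

    blowUpProp-resp : ∀ k a {b : (Fin k → Fin n) → Bool} →
                      b Preserves _≗_ ⟶ _≡_ → blowUpProp k a b Preserves _≗_ ⟶ _≡_
    blowUpProp-resp zero    a b-resp = b-resp
    blowUpProp-resp (suc k) a b-resp {g} {g'} g≗g' = trans
      (blowUpProp-cong k (tail a) (everyHead-cong b-resp (g≗g' ∘ (_↑ˡ sizeB k (tail a)))) (drop (head a) g))
      (blowUpProp-resp k (tail a) (everyHead-resp (take (head a) g') b-resp) (g≗g' ∘ (head a ↑ʳ_)))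

    count-blowUpProp-suc : ∀ k a {b : (Fin (suc k) → Fin n) → Bool} → b Preserves _≗_ ⟶ _≡_ →
      count (sizeB (suc k) a) (blowUpProp (suc k) a b)
        ≡ ∑[ xs ∈ allMaps (head a) n ] count (sizeB k (tail a)) (blowUpProp k (tail a) (everyHead xs b))
    count-blowUpProp-suc k a {b} b-resp = trans
      (∑-allMaps-++ (head a) _ _ (cong 𝟙 ∘ blowUpProp-resp (suc k) a b-resp))
      (∑-cong (allMaps (head a) n) (λ xs → ∑-cong (allMaps (sizeB k (tail a)) n) (λ ys → cong 𝟙 (split xs ys))))
      where
      split : ∀ xs ys → blowUpProp (suc k) a b (xs ++ ys) ≡ blowUpProp k (tail a) (everyHead xs b) ys
      split xs ys = trans (blowUpProp-cong k (tail a) (everyHead-cong b-resp (lookup-++ˡ xs ys)) _)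
                          (blowUpProp-resp k (tail a) (everyHead-resp xs b-resp) (lookup-++ʳ xs ys))

    headCount : ∀ {k} → ((Fin (suc k) → Fin n) → Bool) → (Fin k → Fin n) → ℕ
    headCount b ys = ∑[ x ∈ allFin n ] 𝟙 (b (x ∷ ys))

    count-suc : ∀ k (b : (Fin (suc k) → Fin n) → Bool) → count (suc k) b ≡ ∑[ ys ∈ allMaps k n ] headCount b ys
    count-suc k b = trans (∑-allMaps-suc k _) (∑-comm (allFin n) (allMaps k n) _)

    ∑-count-everyHead : ∀ a k (b : (Fin (suc k) → Fin n) → Bool) →
      ∑[ xs ∈ allMaps a n ] count k (everyHead xs b) ≡ ∑[ ys ∈ allMaps k n ] headCount b ys ^ a
    ∑-count-everyHead a k b = trans (∑-comm (allMaps a n) (allMaps k n) _)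
                                    (∑-cong (allMaps k n) (λ ys → ∑-allMaps-every a (λ x → b (x ∷ ys))))

    count-everyHead-≥ : ∀ a k (b : (Fin (suc k) → Fin n) → Bool) →
      count (suc k) b ^ a * n ^ k ≤ (∑[ xs ∈ allMaps a n ] count k (everyHead xs b)) * (n ^ k) ^ a
    count-everyHead-≥ a k b = begin
      count (suc k) b ^ a * n ^ k                                  ≡⟨ cong₂ (λ c N → c ^ a * N) (count-suc k b) (sym (length-allMaps k)) ⟩
      (∑[ ys ∈ allMaps k n ] headCount b ys) ^ a * length (allMaps k n)  ≤⟨ power-mean (allMaps k n) (headCount b) a ⟩
      (∑[ ys ∈ allMaps k n ] headCount b ys ^ a) * length (allMaps k n) ^ a
        ≡⟨ cong₂ (λ S N → S * N ^ a) (sym (∑-count-everyHead a k b)) (length-allMaps k) ⟩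
      (∑[ xs ∈ allMaps a n ] count k (everyHead xs b)) * (n ^ k) ^ a ∎
      where open ≤-Reasoning

    count-blowUpProp-≥ : ∀ .{{_ : NonZero n}} k a (b : (Fin k → Fin n) → Bool) → b Preserves _≗_ ⟶ _≡_ →
      count k b ^ prodF k a * n ^ sizeB k a ≤ count (sizeB k a) (blowUpProp k a b) * (n ^ k) ^ prodF k a
    count-blowUpProp-≥ zero    a b b-resp = ≤-reflexive (cong (_* 1) (*-identityʳ (count 0 b)))
    count-blowUpProp-≥ (suc k) a b b-resp = subst₂ _≤_
      (cong₂ _*_ (^-*-assoc W a₀ P) (sym (^-distribˡ-+-* n a₀ s)))
      (cong (X *_) (trans (cong₂ _*_ (^-*-assoc n a₀ P) (^-*-assoc (n ^ k) a₀ P))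
                          (sym (^-distribʳ-* n (n ^ k) (a₀ * P)))))
      (cross-≤-chain {(W ^ a₀) ^ P} {V ^ P} {U} {X} {(n ^ k) ^ P} {((n ^ k) ^ a₀) ^ P} {n ^ a₀} {(n ^ a₀) ^ P} {n ^ s}
                     {{m^n≢0 (n ^ k) P {{m^n≢0 n k}}}} averaged-head averaged-tuples summed-IH)
      where
      a₀ = head a
      P  = prodF k (tail a)
      s  = sizeB k (tail a)
      W  = count (suc k) b
      V  = ∑[ xs ∈ allMaps a₀ n ] count k (everyHead xs b)
      U  = ∑[ xs ∈ allMaps a₀ n ] count k (everyHead xs b) ^ P
      X  = count (a₀ + s) (blowUpProp (suc k) a b)

      averaged-head : (W ^ a₀) ^ P * (n ^ k) ^ P ≤ V ^ P * ((n ^ k) ^ a₀) ^ P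
      averaged-head = subst₂ _≤_ (^-distribʳ-* (W ^ a₀) (n ^ k) P) (^-distribʳ-* V ((n ^ k) ^ a₀) P)
                                 (^-monoˡ-≤ P (count-everyHead-≥ a₀ k b))

      averaged-tuples : V ^ P * n ^ a₀ ≤ U * (n ^ a₀) ^ P
      averaged-tuples = subst (λ N → V ^ P * N ≤ U * N ^ P) (length-allMaps a₀)
                              (power-mean (allMaps a₀ n) (λ xs → count k (everyHead xs b)) P)

      summed-IH : U * n ^ s ≤ X * (n ^ k) ^ P
      summed-IH = begin
        U * n ^ s
          ≡⟨ *-distribʳ-∑ (n ^ s) (allMaps a₀ n) _ ⟩
        ∑[ xs ∈ allMaps a₀ n ] count k (everyHead xs b) ^ P * n ^ s
          ≤⟨ ∑-mono-≤ (allMaps a₀ n) (λ xs → count-blowUpProp-≥ k (tail a) (everyHead xs b) (everyHead-resp xs b-resp)) ⟩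
        ∑[ xs ∈ allMaps a₀ n ] count s (blowUpProp k (tail a) (everyHead xs b)) * (n ^ k) ^ P
          ≡⟨ *-distribʳ-∑ ((n ^ k) ^ P) (allMaps a₀ n) _ ⟨
        (∑[ xs ∈ allMaps a₀ n ] count s (blowUpProp k (tail a) (everyHead xs b))) * (n ^ k) ^ P
          ≡⟨ cong (_* (n ^ k) ^ P) (count-blowUpProp-suc k a b-resp) ⟨
        X * (n ^ k) ^ P
          ∎
        where open ≤-Reasoning

    blowUpProp-sound : ∀ k a {b : (Fin k → Fin n) → Bool} → b Preserves _≗_ ⟶ _≡_ →
      ∀ {g} → T (blowUpProp k a b g) → (c : (i : Fin k) → Fin (a i)) → T (b (λ i → g (vertex a i (c i))))
    blowUpProp-sound zero    a b-resp t c = subst T (b-resp (λ ())) t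
    blowUpProp-sound (suc k) a b-resp {g} t c = subst T (b-resp (∷-cong refl (λ _ → refl)))
      (T-every (blowUpProp-sound k (tail a) (everyHead-resp (take (head a) g) b-resp) t (c ∘ suc)) (c zero))

    homᵇ : ∀ {k} → Graph k → Graph n → (Fin k → Fin n) → Bool
    homᵇ H G f = isYes (isHom? H G f)

    homᵇ-resp : ∀ {k} (H : Graph k) (G : Graph n) → homᵇ H G Preserves _≗_ ⟶ _≡_
    homᵇ-resp H G {f} {f'} f≗f' = trans (isYes≗does (isHom? H G f))
      (trans (does-⇔ (mk⇔ (transport f≗f') (transport (sym ∘ f≗f'))) (isHom? H G f) (isHom? H G f'))
             (sym (isYes≗does (isHom? H G f'))))
      where
      transport : ∀ {f f'} → f ≗ f' → IsHom H G f → IsHom H G f'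
      transport f≗f' hom i j = subst₂ (λ u v → T (adj G u v)) (f≗f' i) (f≗f' j) ∘ hom i j

    blowUp-isHom : ∀ {k} (H : Graph k) (G : Graph n) (a : Fin k → ℕ) → (∀ i → a i > 0) →
                   ∀ {g} → T (blowUpProp k a (homᵇ H G) g) → IsHom (blowUp H a) G g
    blowUp-isHom {k} H G a a>0 {g} t x y xy∈E =
      subst₂ (λ u v → T (adj G (g u) (g v))) (hits x c-i) (hits y c-j)
             (toWitness (blowUpProp-sound k a (homᵇ-resp H G) t c) i j xy∈E)
      where
      i = proj k a x
      j = proj k a y
      i≢j : i ≢ j
      i≢j i≡j = subst T (irrefl H j) (subst (λ z → T (adj H z j)) i≡j xy∈E)
      c = update (update (λ i → fromℕ< (a>0 i)) i (proj₁ (vertex-proj a x))) j (proj₁ (vertex-proj a y))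
      c-i : c i ≡ proj₁ (vertex-proj a x)
      c-i = trans (update-≢ _ _ (i≢j ∘ sym)) (update-≡ _ i _)
      c-j : c j ≡ proj₁ (vertex-proj a y)
      c-j = update-≡ _ j _
      hits : ∀ z → c (proj k a z) ≡ proj₁ (vertex-proj a z) → vertex a (proj k a z) (c (proj k a z)) ≡ z
      hits z c≡ = trans (cong (vertex a (proj k a z)) c≡) (proj₂ (vertex-proj a z))

    hom-blowUp-≥ : ∀ .{{_ : NonZero n}} {k} (H : Graph k) (G : Graph n) (a : Fin k → ℕ) → (∀ i → a i > 0) →
                   hom H G ^ prodF k a * n ^ sizeB k a ≤ hom (blowUp H a) G * (n ^ k) ^ prodF k a
    hom-blowUp-≥ {k} H G a a>0 = begin
      hom H G ^ P * n ^ s                                ≡⟨ cong (λ h → h ^ P * n ^ s) (length-filter (isHom? H G) (allMaps k n)) ⟩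
      count k (homᵇ H G) ^ P * n ^ s                     ≤⟨ count-blowUpProp-≥ k a (homᵇ H G) (homᵇ-resp H G) ⟩
      count s (blowUpProp k a (homᵇ H G)) * (n ^ k) ^ P  ≤⟨ *-monoˡ-≤ _ (∑-mono-≤ (allMaps s n) (λ g → 𝟙-mono (isHom g))) ⟩
      count s (homᵇ (blowUp H a) G) * (n ^ k) ^ P        ≡⟨ cong (_* (n ^ k) ^ P) (length-filter (isHom? (blowUp H a) G) (allMaps s n)) ⟨
      hom (blowUp H a) G * (n ^ k) ^ P                   ∎
      where
      open ≤-Reasoning
      P = prodF k a
      s = sizeB k a
      isHom : ∀ g → T (blowUpProp k a (homᵇ H G) g) → T (homᵇ (blowUp H a) G g)
      isHom g = fromWitness ∘ blowUp-isHom H G a a>0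

open import Data.Integer as ℤ using (+_)
open import Data.Integer.Properties using (pos-*)
open import Data.Nat as ℕ using (ℕ; zero; suc; _>_; NonZero)
open import Data.Nat.Properties using (m^n≢0; m*n≢0)
open import Data.Fin using (Fin)
open import Data.Rational using (_/_; _≤_; _*_; toℚᵘ)
open import Data.Rational.Properties using (toℚᵘ-homo-*; toℚᵘ-injective; toℚᵘ-fromℚᵘ; toℚᵘ-cancel-≤; module ≤-Reasoning)
open import Data.Rational.Unnormalised as ℚᵘ using (mkℚᵘ; *≤*)
import Data.Rational.Unnormalised.Properties as ℚᵘ
open import Relation.Binary.PropositionalEquality
open import Defs hiding (sym)
open Counting using (hom-blowUp-≥)

/-* : ∀ a b d e .{{_ : NonZero d}} .{{_ : NonZero e}} →
      + a / d * (+ b / e) ≡ _/_ (+ (a ℕ.* b)) (d ℕ.* e) {{m*n≢0 d e}}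
/-* a b (suc d) (suc e) = toℚᵘ-injective (begin
  toℚᵘ (+ a / suc d * (+ b / suc e))              ≈⟨ toℚᵘ-homo-* (+ a / suc d) (+ b / suc e) ⟩
  toℚᵘ (+ a / suc d) ℚᵘ.* toℚᵘ (+ b / suc e)      ≈⟨ ℚᵘ.*-cong (toℚᵘ-fromℚᵘ (mkℚᵘ (+ a) d)) (toℚᵘ-fromℚᵘ (mkℚᵘ (+ b) e)) ⟩
  mkℚᵘ (+ a) d ℚᵘ.* mkℚᵘ (+ b) e                  ≡⟨ cong (λ i → mkℚᵘ i (e ℕ.+ d ℕ.* suc e)) (sym (pos-* a b)) ⟩
  mkℚᵘ (+ (a ℕ.* b)) (e ℕ.+ d ℕ.* suc e)          ≈⟨ ℚᵘ.≃-sym (toℚᵘ-fromℚᵘ _) ⟩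
  toℚᵘ (+ (a ℕ.* b) / (suc d ℕ.* suc e))          ∎)
  where open ℚᵘ.≃-Reasoning

/-^ℚ : ∀ a d .{{_ : NonZero d}} e → (+ a / d) ^ℚ e ≡ _/_ (+ (a ℕ.^ e)) (d ℕ.^ e) {{m^n≢0 d e}}
/-^ℚ a d zero    = refl
/-^ℚ a d (suc e) = trans (cong (+ a / d *_) (/-^ℚ a d e)) (/-* a (a ℕ.^ e) d (d ℕ.^ e))
  where instance _ = m^n≢0 d e

/-≤ : ∀ a b {d e} .{{_ : NonZero d}} .{{_ : NonZero e}} → a ℕ.* e ℕ.≤ b ℕ.* d → + a / d ≤ + b / e
/-≤ a b {suc d} {suc e} ae≤bd = toℚᵘ-cancel-≤
  (ℚᵘ.≤-respˡ-≃ (ℚᵘ.≃-sym (toℚᵘ-fromℚᵘ (mkℚᵘ (+ a) d))) (ℚᵘ.≤-respʳ-≃ (ℚᵘ.≃-sym (toℚᵘ-fromℚᵘ (mkℚᵘ (+ b) e)))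
    (*≤* (subst₂ ℤ._≤_ (pos-* a (suc e)) (pos-* b (suc d)) (ℤ.+≤+ ae≤bd)))))

lemma2p2 : (k : ℕ) (H : Graph k) (a : Fin k → ℕ) → (∀ i → a i > 0) →
    (m : ℕ) (G : Graph (suc m)) →
    t H G ^ℚ prodF k a ≤ t (blowUp H a) G
lemma2p2 k H a a>0 m G = begin
  t H G ^ℚ P                                     ≡⟨ /-^ℚ (hom H G) (suc m ℕ.^ k) P ⟩
  + (hom H G ℕ.^ P) / (suc m ℕ.^ k) ℕ.^ P        ≤⟨ /-≤ (hom H G ℕ.^ P) (hom (blowUp H a) G) (hom-blowUp-≥ H G a a>0) ⟩
  + hom (blowUp H a) G / suc m ℕ.^ sizeB k a     ∎
  where
  open ≤-Reasoning
  P = prodF k a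
  instance
    _ = m^n≢0 (suc m) k
    _ = m^n≢0 (suc m ℕ.^ k) P
    _ = m^n≢0 (suc m) (sizeB k a)
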